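{- For every integer $k\ge 0$, the graph $AB_k$ is planar, and for every $k\ge 2$, $AB_k$ is not series-parallel.
   Context: The binomial tree $BT_0$ is a single vertex (its root); for $k\ge1$, $BT_k$ is obtained from two disjoint copies of $BT_{k-1}$ by adding an edge between their roots, one of which becomes the root. $B_k$ is $BT_k$ rooted at $s$ together with a new vertex $t$ adjacent to all $2^k$ vertices of $BT_k$. The Accelerated-Binomial graph $AB_k$ (with distinguished vertices $s,t$, on $2^k+1$ vertices) is defined as follows: for $0\le k\le 3$, $AB_k$ is $B_k$ with an added edge from $s$ to every vertex of $BT_k$ not already adjacent to $s$. For $k=3m+j$ with $m\ge1$ and $j\in\{1,2,3\}$, $AB_k$ is obtained from $AB_{3m}$ by replacing, for every vertex $v\ne t$ of $AB_{3m}$, the edge $\{v,t\}$ by a copy of $AB_j$ whose vertex $s$ is identified with $v$ and whose vertex $t$ is identified with $t$. A simple graph is series-parallel if it can be obtained from $K_2$ by a finite sequence of series extensions (replace an edge $\{x,y\}$ by a new vertex $z$ and edges $\{x,z\},\{z,y\}$) and parallel extensions (add an edge parallel to an existing edge), with no multiple edges at the end. -}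

module Defs where

open import Data.Nat using (ℕ; zero; suc; _∸_; _*_)
open import Data.Nat.DivMod using (_/_)
open import Data.Bool using (Bool; true; false)
open import Data.Vec using (Vec; []; _∷_; replicate)
open import Data.Maybe using (Maybe; just; nothing)
open import Data.Fin using (Fin; inject₁; fromℕ) renaming (zero to fz; suc to fs)
open import Data.List using (List; []; _∷_; _++_; map)
open import Data.List.Membership.Propositional using (_∈_)
open import Data.List.Relation.Unary.AllPairs using (AllPairs)
open import Data.Product using (Σ; ∃; _×_; _,_)
open import Data.Sum using (_⊎_)
open import Data.Empty using (⊥)
open import Data.Unit using (⊤)
open import Relation.Nullary using (¬_)
open import Relation.Binary.PropositionalEquality using (_≡_; _≢_)
open import Function.Bundles using (_↔_; Inverse; _⇔_)
open import Data.Rational using (ℚ; 0ℚ; 1ℚ; _+_; _-_; _≤_)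
  renaming (_*_ to _*q_)

record Graph : Set₁ where
  field
    V   : Set
    Adj : V → V → Set

-- BT_k has vertex set Vec Bool k; the first bit says
-- which of the two copies of BT_(k-1) a vertex lies in; the root is the
-- all-false vector; the two copies are joined by an edge between their
-- roots (the root of copy 'false' is the root of BT_k).

root : (k : ℕ) → Vec Bool k
root k = replicate k false

BTAdj : (k : ℕ) → Vec Bool k → Vec Bool k → Set
BTAdj zero _ _ = ⊥
BTAdj (suc k) (x ∷ u) (y ∷ v) =
  (x ≡ y × BTAdj k u v) ⊎ (u ≡ root k × v ≡ root k × x ≢ y)

-- An s-t graph in which t is adjacent to every other vertex.  Its vertex
-- set is  Maybe W  with  nothing = t ; 'E' is the adjacency among the
-- vertices different from t.

record STData : Set₁ where
  field
    W : Set
    s : W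
    E : W → W → Set

open STData

-- B_k together with the extra edges from s to every vertex of BT_k
-- (this is AB_k for k ≤ 3).
smallAB : ℕ → STData
smallAB k = record
  { W = Vec Bool k
  ; s = root k
  ; E = λ u v → BTAdj k u v
                ⊎ (u ≡ root k × v ≢ root k)
                ⊎ (v ≡ root k × u ≢ root k)
  }

-- Replace, for every vertex v ≠ t of A, the edge {v,t} by a copy of C
-- (C's s identified with v, C's t identified with t).  A vertex (a , x)
-- is vertex x of the copy of C attached at a; (a , s_C) is a itself.
compose : STData → STData → STData
compose A C = record
  { W = W A × W C
  ; s = s A , s C
  ; E = λ { (a , x) (b , y) →
            (x ≡ s C × y ≡ s C × E A a b) ⊎ (a ≡ b × E C x y) }
  }

-- AB_(3m) for m ≥ 1 (argument m):  AB_3, and AB_(3(m+1)) = AB_(3m)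
-- with every {v,t} replaced by AB_3.
ABm : ℕ → STData
ABm zero = smallAB 0            -- unused (m ≥ 1 in the definition)
ABm (suc zero) = smallAB 3
ABm (suc (suc m)) = compose (ABm (suc m)) (smallAB 3)

-- AB_k.  For k ≥ 4 write k = 3m + j with m = (k-1)/3 ≥ 1, j ∈ {1,2,3}.
ABdata : ℕ → STData
ABdata 0 = smallAB 0
ABdata 1 = smallAB 1
ABdata 2 = smallAB 2
ABdata 3 = smallAB 3
ABdata k@(suc (suc (suc (suc n)))) =
  compose (ABm ((3 Data.Nat.+ n) / 3)) (smallAB (k ∸ 3 * ((3 Data.Nat.+ n) / 3)))

stGraph : STData → Graph
stGraph D = record { V = Maybe (W D) ; Adj = adj }
  where
  adj : Maybe (W D) → Maybe (W D) → Set
  adj nothing nothing = ⊥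
  adj nothing (just _) = ⊤
  adj (just _) nothing = ⊤
  adj (just a) (just b) = E D a b

AB : ℕ → Graph
AB k = stGraph (ABdata k)

-- Planarity: existence of a plane straight-line drawing with rational
-- coordinates (vertices at distinct points, no vertex in the interior
-- of an edge, two distinct edges meet only at endpoints).

Point : Set
Point = ℚ × ℚ

pointOn : Point → Point → ℚ → Point
pointOn (a₁ , a₂) (b₁ , b₂) l = (a₁ + l *q (b₁ - a₁)) , (a₂ + l *q (b₂ - a₂))

OnSegment : Point → Point → Point → Set
OnSegment q a b = Σ ℚ λ l → (0ℚ ≤ l) × (l ≤ 1ℚ) × (q ≡ pointOn a b l)

record StraightLineDrawing (G : Graph) : Set where
  open Graph G
  field
    pos       : V → Point
    injective : ∀ u v → pos u ≡ pos v → u ≡ v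
    noVertexOnEdge : ∀ u v w → Adj u v → w ≢ u → w ≢ v →
                     ¬ OnSegment (pos w) (pos u) (pos v)
    noCrossing : ∀ u v w x → Adj u v → Adj w x →
                 ¬ ((u ≡ w × v ≡ x) ⊎ (u ≡ x × v ≡ w)) →
                 ∀ q → OnSegment q (pos u) (pos v) → OnSegment q (pos w) (pos x) →
                 (q ≡ pos u) ⊎ (q ≡ pos v)

Planar : Graph → Set
Planar G = StraightLineDrawing G

-- Series-parallel graphs.  Multigraphs reachable from K₂ by series and
-- parallel extensions, as edge lists on Fin n (edges unordered).

data SPMulti : (n : ℕ) → List (Fin n × Fin n) → Set where
  k2       : SPMulti 2 ((fz , fs fz) ∷ [])
  series   : ∀ {n} (xs ys : List (Fin n × Fin n)) (x y : Fin n) →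
             SPMulti n (xs ++ (x , y) ∷ ys) →
             SPMulti (suc n)
               (map (λ { (a , b) → inject₁ a , inject₁ b }) xs
                 ++ (inject₁ x , fromℕ n) ∷ (fromℕ n , inject₁ y)
                 ∷ map (λ { (a , b) → inject₁ a , inject₁ b }) ys)
  parallel : ∀ {n} {es : List (Fin n × Fin n)} {e} →
             SPMulti n es → e ∈ es → SPMulti n (e ∷ es)

SameEdge : ∀ {n} → Fin n × Fin n → Fin n × Fin n → Set
SameEdge (a , b) (c , d) = (a ≡ c × b ≡ d) ⊎ (a ≡ d × b ≡ c)

HasEdge : ∀ {n} → List (Fin n × Fin n) → Fin n → Fin n → Set
HasEdge es x y = ((x , y) ∈ es) ⊎ ((y , x) ∈ es)

SeriesParallel : Graph → Set
SeriesParallel G =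
  Σ ℕ λ n → Σ (List (Fin n × Fin n)) λ es →
    SPMulti n es ×
    AllPairs (λ e f → ¬ SameEdge e f) es ×
    Σ (Fin n ↔ Graph.V G) λ f →
      ∀ x y → Graph.Adj G (Inverse.to f x) (Inverse.to f y) ⇔ HasEdge es x y

-- Deleting t from AB_k leaves a graph with a one-page book embedding in which s comes first:
-- for k ≤ 3 one is found by exhaustive check, and the composition that replaces each edge
-- {v , t} by a copy of AB_j puts the embedding of that copy into a block of consecutive
-- positions next to v.  Put the vertex of rank r at (r , r²) and t at (0 , -N²), N bounding
-- the ranks.  The arcs of the book embedding become chords of the parabola, which do not cross
-- because the arcs nest or are disjoint, and the segment from t to c separates the vertices left
-- of c from those right of c; so this is a straight-line drawing.
-- For k ≥ 2, t together with a triangle of AB_2 or AB_3 (which survives in every composition)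
-- forms a K₄, while series and parallel extensions never create a K₄: the vertex added by a
-- series extension has only two neighbours.

module Submission where

open import Data.Product as Product using (Σ; _×_; _,_; proj₁; proj₂)
open import Data.Sum as Sum using (_⊎_; inj₁; inj₂)
open import Data.Empty using (⊥; ⊥-elim)
open import Function using (_∘_; id)
open import Relation.Nullary using (¬_; Dec; yes; no)
open import Relation.Binary.Definitions using (tri<; tri≈; tri>)
open import Relation.Binary.PropositionalEquality
  using (_≡_; _≢_; refl; sym; trans; cong; cong₂; subst; subst₂; module ≡-Reasoning)
open import Defs

module PlaneGeometry where

  open import Data.Nat as ℕ using (ℕ; suc)
  import Data.Nat.Properties as ℕ
  open import Data.Rational
    using (ℚ; 0ℚ; 1ℚ; _+_; _*_; _-_; -_; 1/_; _≤_; _<_; nonNegative; nonPositive; ≢-nonZero)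
  open import Data.Rational.Properties
  open import Data.Rational.Solver using (module +-*-Solver)
  open import Algebra.Bundles using (CommutativeRing)
  open import Algebra.Properties.Group +-0-group using (x∙y⁻¹≈ε⇒x≈y)
  open import Algebra.Properties.Semiring.Mult (CommutativeRing.semiring +-*-commutativeRing)
    using (×1-homo-*) renaming (_×_ to _·_)
  open +-*-Solver

  SameSign : ℚ → ℚ → Set
  SameSign p q = (0ℚ ≤ p × 0ℚ ≤ q) ⊎ (p ≤ 0ℚ × q ≤ 0ℚ)

  OppositeSign : ℚ → ℚ → Set
  OppositeSign p q = (0ℚ ≤ p × q ≤ 0ℚ) ⊎ (p ≤ 0ℚ × 0ℚ ≤ q)

  sameSign-sym : ∀ {p q} → SameSign p q → SameSign q p
  sameSign-sym = Sum.map Product.swap Product.swap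

  sameSign-0ˡ : ∀ q → SameSign 0ℚ q
  sameSign-0ˡ q with ≤-total 0ℚ q
  ... | inj₁ 0≤q = inj₁ (≤-refl , 0≤q)
  ... | inj₂ q≤0 = inj₂ (≤-refl , q≤0)

  sameSign⇒0≤* : ∀ {p q} → SameSign p q → 0ℚ ≤ p * q
  sameSign⇒0≤* {p} {q} (inj₁ (0≤p , 0≤q)) =
    nonNegative⁻¹ _ {{nonNeg*nonNeg⇒nonNeg p {{nonNegative 0≤p}} q {{nonNegative 0≤q}}}}
  sameSign⇒0≤* {p} {q} (inj₂ (p≤0 , q≤0)) =
    nonNegative⁻¹ _ {{nonPos*nonPos⇒nonPos p {{nonPositive p≤0}} q {{nonPositive q≤0}}}}

  oppositeSign⇒*≤0 : ∀ {p q} → OppositeSign p q → p * q ≤ 0ℚ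
  oppositeSign⇒*≤0 {p} {q} (inj₁ (0≤p , q≤0)) =
    nonPositive⁻¹ _ {{nonNeg*nonPos⇒nonPos p {{nonNegative 0≤p}} q {{nonPositive q≤0}}}}
  oppositeSign⇒*≤0 {p} {q} (inj₂ (p≤0 , 0≤q)) =
    nonPositive⁻¹ _ {{nonPos*nonNeg⇒nonPos p {{nonPositive p≤0}} q {{nonNegative 0≤q}}}}

  sameSign-scale : ∀ {a b p q} → 0ℚ ≤ a → 0ℚ ≤ b → SameSign p q → SameSign (a * p) (b * q)
  sameSign-scale 0≤a 0≤b (inj₁ (0≤p , 0≤q)) =
    inj₁ (sameSign⇒0≤* (inj₁ (0≤a , 0≤p)) , sameSign⇒0≤* (inj₁ (0≤b , 0≤q)))
  sameSign-scale 0≤a 0≤b (inj₂ (p≤0 , q≤0)) =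
    inj₂ (oppositeSign⇒*≤0 (inj₁ (0≤a , p≤0)) , oppositeSign⇒*≤0 (inj₁ (0≤b , q≤0)))

  sameSign-p+q≡0 : ∀ {p q} → SameSign p q → p + q ≡ 0ℚ → p ≡ 0ℚ × q ≡ 0ℚ
  sameSign-p+q≡0 {p} {q} (inj₁ (0≤p , 0≤q)) p+q≡0 =
    ≤-antisym (subst₂ _≤_ (+-identityʳ p) p+q≡0 (+-monoʳ-≤ p 0≤q)) 0≤p ,
    ≤-antisym (subst₂ _≤_ (+-identityˡ q) p+q≡0 (+-monoˡ-≤ q 0≤p)) 0≤q
  sameSign-p+q≡0 {p} {q} (inj₂ (p≤0 , q≤0)) p+q≡0 =
    ≤-antisym p≤0 (subst₂ _≤_ p+q≡0 (+-identityʳ p) (+-monoʳ-≤ p q≤0)) ,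
    ≤-antisym q≤0 (subst₂ _≤_ p+q≡0 (+-identityˡ q) (+-monoˡ-≤ q p≤0))

  p*q≡0⇒p≡0∨q≡0 : ∀ {p q} → p * q ≡ 0ℚ → p ≡ 0ℚ ⊎ q ≡ 0ℚ
  p*q≡0⇒p≡0∨q≡0 {p} {q} pq≡0 with p ≟ 0ℚ
  ... | yes p≡0 = inj₁ p≡0
  ... | no p≢0  = inj₂ (begin
    q              ≡⟨ *-identityˡ q ⟨
    1ℚ * q         ≡⟨ cong (_* q) (*-inverseˡ p) ⟨
    (1/ p * p) * q ≡⟨ *-assoc (1/ p) p q ⟩
    1/ p * (p * q) ≡⟨ cong (1/ p *_) pq≡0 ⟩
    1/ p * 0ℚ      ≡⟨ *-zeroʳ (1/ p) ⟩
    0ℚ             ∎)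
    where
    open ≡-Reasoning
    instance _ = ≢-nonZero p≢0

  p-q≡0⇒p≡q : ∀ {p q} → p - q ≡ 0ℚ → p ≡ q
  p-q≡0⇒p≡q {p} {q} = x∙y⁻¹≈ε⇒x≈y p q

  p≤q⇒0≤q-p : ∀ {p q} → p ≤ q → 0ℚ ≤ q - p
  p≤q⇒0≤q-p {p} {q} p≤q = subst (_≤ q - p) (+-inverseʳ p) (+-monoˡ-≤ (- p) p≤q)

  p≤q⇒p-q≤0 : ∀ {p q} → p ≤ q → p - q ≤ 0ℚ
  p≤q⇒p-q≤0 {p} {q} p≤q = subst (p - q ≤_) (+-inverseʳ q) (+-monoˡ-≤ (- q) p≤q)

  p<q⇒p-q<0 : ∀ {p q} → p < q → p - q < 0ℚ
  p<q⇒p-q<0 {p} {q} p<q = subst (p - q <_) (+-inverseʳ q) (+-monoˡ-< (- q) p<q)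

  ι : ℕ → ℚ
  ι n = n · 1ℚ

  ι-homo-* : ∀ m n → ι (m ℕ.* n) ≡ ι m * ι n
  ι-homo-* = ×1-homo-*

  ι<ι-suc : ∀ n → ι n < ι (suc n)
  ι<ι-suc n = subst (_< ι (suc n)) (+-identityˡ (ι n)) (+-monoˡ-< (ι n) (positive⁻¹ 1ℚ))

  ι-mono-< : ∀ {m n} → m ℕ.< n → ι m < ι n
  ι-mono-< {m} {suc n} (ℕ.s≤s m≤n) with ℕ.m≤n⇒m<n∨m≡n m≤n
  ... | inj₁ m<n  = <-trans (ι-mono-< m<n) (ι<ι-suc n)
  ... | inj₂ refl = ι<ι-suc n

  ι-mono-≤ : ∀ {m n} → m ℕ.≤ n → ι m ≤ ι n
  ι-mono-≤ m≤n with ℕ.m≤n⇒m<n∨m≡n m≤n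
  ... | inj₁ m<n  = <⇒≤ (ι-mono-< m<n)
  ... | inj₂ refl = ≤-refl

  ι-injective : ∀ {m n} → ι m ≡ ι n → m ≡ n
  ι-injective {m} {n} ιm≡ιn with ℕ.<-cmp m n
  ... | tri< m<n _ _ = ⊥-elim (<⇒≢ (ι-mono-< m<n) ιm≡ιn)
  ... | tri≈ _ m≡n _ = m≡n
  ... | tri> _ _ n<m = ⊥-elim (<⇒≢ (ι-mono-< n<m) (sym ιm≡ιn))

  record AffineForm : Set where
    constructor affineForm
    field
      α β γ : ℚ

  infix 8 _at_

  _at_ : AffineForm → Point → ℚ
  affineForm α β γ at (x , y) = α * x + β * y + γ

  at-pointOn : ∀ f P Q l → f at pointOn P Q l ≡ (1ℚ - l) * f at P + l * f at Q
  at-pointOn (affineForm α β γ) (p₁ , p₂) (q₁ , q₂) l =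
    solve 8 (λ α β γ p₁ p₂ q₁ q₂ l →
               α :* (p₁ :+ l :* (q₁ :- p₁)) :+ β :* (p₂ :+ l :* (q₂ :- p₂)) :+ γ
               := (con 1ℚ :- l) :* (α :* p₁ :+ β :* p₂ :+ γ) :+ l :* (α :* q₁ :+ β :* q₂ :+ γ))
      refl α β γ p₁ p₂ q₁ q₂ l

  pointOn-0 : ∀ P Q → pointOn P Q 0ℚ ≡ P
  pointOn-0 (p₁ , p₂) (q₁ , q₂) = cong₂ _,_ (coordinate p₁ q₁) (coordinate p₂ q₂)
    where
    coordinate : ∀ p q → p + 0ℚ * (q - p) ≡ p
    coordinate = solve 2 (λ p q → p :+ con 0ℚ :* (q :- p) := p) refl

  pointOn-1 : ∀ P Q → pointOn P Q 1ℚ ≡ Q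
  pointOn-1 (p₁ , p₂) (q₁ , q₂) = cong₂ _,_ (coordinate p₁ q₁) (coordinate p₂ q₂)
    where
    coordinate : ∀ p q → p + 1ℚ * (q - p) ≡ q
    coordinate = solve 2 (λ p q → p :+ con 1ℚ :* (q :- p) := q) refl

  onSegment-degenerate : ∀ {q P} → OnSegment q P P → q ≡ P
  onSegment-degenerate {P = p₁ , p₂} (l , _ , _ , refl) = cong₂ _,_ (coordinate p₁ l) (coordinate p₂ l)
    where
    coordinate : ∀ p l → p + l * (p - p) ≡ p
    coordinate = solve 2 (λ p l → p :+ l :* (p :- p) := p) refl

  vanishes-onSegment : ∀ f {q P Q} → f at P ≡ 0ℚ → f at Q ≡ 0ℚ → OnSegment q P Q → f at q ≡ 0ℚ
  vanishes-onSegment f {P = P} {Q} fP≡0 fQ≡0 (l , _ , _ , refl) = begin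
    f at pointOn P Q l              ≡⟨ at-pointOn f P Q l ⟩
    (1ℚ - l) * f at P + l * f at Q  ≡⟨ cong₂ (λ u v → (1ℚ - l) * u + l * v) fP≡0 fQ≡0 ⟩
    (1ℚ - l) * 0ℚ + l * 0ℚ          ≡⟨ cong₂ _+_ (*-zeroʳ (1ℚ - l)) (*-zeroʳ l) ⟩
    0ℚ + 0ℚ                         ≡⟨ +-identityˡ 0ℚ ⟩
    0ℚ                              ∎
    where open ≡-Reasoning

  zero-onSegment : ∀ f {q P Q} → OnSegment q P Q → f at q ≡ 0ℚ → SameSign (f at P) (f at Q) →
                   (q ≡ Q ⊎ f at P ≡ 0ℚ) × (q ≡ P ⊎ f at Q ≡ 0ℚ)
  zero-onSegment f {P = P} {Q} (l , 0≤l , l≤1 , refl) fq≡0 sides =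
    atQ (p*q≡0⇒p≡0∨q≡0 (proj₁ terms≡0)) , atP (p*q≡0⇒p≡0∨q≡0 (proj₂ terms≡0))
    where
    terms≡0 : (1ℚ - l) * f at P ≡ 0ℚ × l * f at Q ≡ 0ℚ
    terms≡0 = sameSign-p+q≡0 (sameSign-scale (p≤q⇒0≤q-p l≤1) 0≤l sides)
                             (trans (sym (at-pointOn f P Q l)) fq≡0)
    atQ : 1ℚ - l ≡ 0ℚ ⊎ f at P ≡ 0ℚ → pointOn P Q l ≡ Q ⊎ f at P ≡ 0ℚ
    atQ (inj₁ 1-l≡0) =
      inj₁ (trans (cong (pointOn P Q) (sym (p-q≡0⇒p≡q {1ℚ} {l} 1-l≡0))) (pointOn-1 P Q))
    atQ (inj₂ fP≡0)  = inj₂ fP≡0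
    atP : l ≡ 0ℚ ⊎ f at Q ≡ 0ℚ → pointOn P Q l ≡ P ⊎ f at Q ≡ 0ℚ
    atP (inj₁ l≡0)  = inj₁ (trans (cong (pointOn P Q) l≡0) (pointOn-0 P Q))
    atP (inj₂ fQ≡0) = inj₂ fQ≡0

  record SeparatingLines (G : Graph) : Set where
    open Graph G
    field
      pos           : V → Point
      pos-injective : ∀ u v → pos u ≡ pos v → u ≡ v
      line          : ∀ u v → Adj u v → AffineForm
      line-through  : ∀ u v (e : Adj u v) → line u v e at pos u ≡ 0ℚ × line u v e at pos v ≡ 0ℚ
      line-avoids   : ∀ u v (e : Adj u v) w → line u v e at pos w ≡ 0ℚ → w ≡ u ⊎ w ≡ v
      separates     : ∀ u v w x (e : Adj u v) (e′ : Adj w x) →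
                      SameSign (line u v e at pos w) (line u v e at pos x) ⊎
                      SameSign (line w x e′ at pos u) (line w x e′ at pos v)

  module _ {G : Graph} (S : SeparatingLines G) where
    open Graph G
    open SeparatingLines S

    private
      SameEnds : V → V → V → V → Set
      SameEnds u v w x = (u ≡ w × v ≡ x) ⊎ (u ≡ x × v ≡ w)

      sameEnds-swap : ∀ {u v w x} → SameEnds w x u v → SameEnds u v w x
      sameEnds-swap (inj₁ (refl , refl)) = inj₁ (refl , refl)
      sameEnds-swap (inj₂ (refl , refl)) = inj₂ (refl , refl)

      line-onSegment : ∀ {u v q} (e : Adj u v) → OnSegment q (pos u) (pos v) → line u v e at q ≡ 0ℚ
      line-onSegment {u} {v} e =
        vanishes-onSegment (line u v e) (proj₁ (line-through u v e)) (proj₂ (line-through u v e))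

      vertex-onSegment : ∀ {u v w q} (e : Adj u v) → OnSegment q (pos u) (pos v) → q ≡ pos w →
                         q ≡ pos u ⊎ q ≡ pos v
      vertex-onSegment {u} {v} {w} e q∈uv refl with line-avoids u v e w (line-onSegment e q∈uv)
      ... | inj₁ refl = inj₁ refl
      ... | inj₂ refl = inj₂ refl

      meet-at-end : ∀ {u v w x q} (e : Adj u v) → ¬ SameEnds u v w x →
                    OnSegment q (pos u) (pos v) → OnSegment q (pos w) (pos x) →
                    SameSign (line u v e at pos w) (line u v e at pos x) → q ≡ pos u ⊎ q ≡ pos v
      meet-at-end {u} {v} {w} {x} e ¬same q∈uv q∈wx sides
        with zero-onSegment (line u v e) q∈wx (line-onSegment e q∈uv) sides
      ... | inj₁ q≡x , _ = vertex-onSegment e q∈uv q≡x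
      ... | _ , inj₁ q≡w = vertex-onSegment e q∈uv q≡w
      ... | inj₂ ew≡0 , inj₂ ex≡0 with line-avoids u v e w ew≡0 | line-avoids u v e x ex≡0
      ...   | inj₁ refl | inj₁ refl = inj₁ (onSegment-degenerate q∈wx)
      ...   | inj₂ refl | inj₂ refl = inj₂ (onSegment-degenerate q∈wx)
      ...   | inj₁ refl | inj₂ refl = ⊥-elim (¬same (inj₁ (refl , refl)))
      ...   | inj₂ refl | inj₁ refl = ⊥-elim (¬same (inj₂ (refl , refl)))

    separatingLines⇒drawing : StraightLineDrawing G
    separatingLines⇒drawing = record
      { pos            = pos
      ; injective      = pos-injective
      ; noVertexOnEdge = λ u v w e w≢u w≢v w∈uv →
                           Sum.[ w≢u , w≢v ] (line-avoids u v e w (line-onSegment e w∈uv))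
      ; noCrossing     = noCrossing
      }
      where
      noCrossing : ∀ u v w x → Adj u v → Adj w x → ¬ SameEnds u v w x →
                   ∀ q → OnSegment q (pos u) (pos v) → OnSegment q (pos w) (pos x) →
                   q ≡ pos u ⊎ q ≡ pos v
      noCrossing u v w x e e′ ¬same q q∈uv q∈wx with separates u v w x e e′
      ... | inj₁ sides = meet-at-end e ¬same q∈uv q∈wx sides
      ... | inj₂ sides with meet-at-end e′ (¬same ∘ sameEnds-swap) q∈wx q∈uv sides
      ...   | inj₁ q≡w = vertex-onSegment e q∈uv q≡w
      ...   | inj₂ q≡x = vertex-onSegment e q∈uv q≡x

  parabola : ℚ → Point
  parabola x = x , x * x

  chord : ℚ → ℚ → AffineForm
  chord a b = affineForm (- (a + b)) 1ℚ (a * b)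

  spoke : ℚ → ℚ → AffineForm
  spoke m c = affineForm (- (c * c + m)) c (c * m)

  chord-through : ∀ a b → chord a b at parabola a ≡ 0ℚ × chord a b at parabola b ≡ 0ℚ
  chord-through a b =
    solve 2 (λ a b → :- (a :+ b) :* a :+ con 1ℚ :* (a :* a) :+ a :* b := con 0ℚ) refl a b ,
    solve 2 (λ a b → :- (a :+ b) :* b :+ con 1ℚ :* (b :* b) :+ a :* b := con 0ℚ) refl a b

  spoke-through : ∀ m c → spoke m c at (0ℚ , - m) ≡ 0ℚ × spoke m c at parabola c ≡ 0ℚ
  spoke-through m c =
    solve 2 (λ m c → :- (c :* c :+ m) :* con 0ℚ :+ c :* (:- m) :+ c :* m := con 0ℚ) refl m c ,
    solve 2 (λ m c → :- (c :* c :+ m) :* c :+ c :* (c :* c) :+ c :* m := con 0ℚ) refl m c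

  chord-at-parabola : ∀ a b c → chord a b at parabola c ≡ (c - a) * (c - b)
  chord-at-parabola = solve 3 (λ a b c →
    :- (a :+ b) :* c :+ con 1ℚ :* (c :* c) :+ a :* b := (c :- a) :* (c :- b)) refl

  chord-at-apex : ∀ a b m → chord a b at (0ℚ , - m) ≡ a * b - m
  chord-at-apex = solve 3 (λ a b m →
    :- (a :+ b) :* con 0ℚ :+ con 1ℚ :* (:- m) :+ a :* b := a :* b :- m) refl

  spoke-at-parabola : ∀ m c d → spoke m c at parabola d ≡ (d - c) * (c * d - m)
  spoke-at-parabola = solve 3 (λ m c d →
    :- (c :* c :+ m) :* d :+ c :* (d :* d) :+ c :* m := (d :- c) :* (c :* d :- m)) refl

open PlaneGeometry

module BookEmbeddings where

  open import Data.Nat using (ℕ; suc; _+_; _*_; _≤_; _<_; _≤?_)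
  open import Data.Nat.Properties

  Within : ℕ → ℕ → ℕ → Set
  Within i k x = (i ≤ x × x ≤ k) ⊎ (k ≤ x × x ≤ i)

  Outside : ℕ → ℕ → ℕ → Set
  Outside i k x = (x ≤ i × x ≤ k) ⊎ (i ≤ x × k ≤ x)

  -- The arcs joining positions i , k and j , l on one side of a line do not cross.
  NonCrossing : ℕ → ℕ → ℕ → ℕ → Set
  NonCrossing i k j l = (Outside i k j × Outside i k l) ⊎ (Within i k j × Within i k l)

  -- A one-page book embedding of the graph D minus t, with s in the first position.
  record OnePageEmbedding (D : STData) : Set where
    open STData D
    field
      rank           : W → ℕ
      bound          : ℕ
      rank<bound     : ∀ a → rank a < bound
      rank-injective : ∀ a b → rank a ≡ rank b → a ≡ b
      s-first        : ∀ a → rank s ≤ rank a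
      nonCrossing    : ∀ {a b c d} → E a b → E c d → NonCrossing (rank a) (rank b) (rank c) (rank d)

  nonCrossing-mono : ∀ (f : ℕ → ℕ) → (∀ {i j} → i ≤ j → f i ≤ f j) →
                     ∀ {i k j l} → NonCrossing i k j l → NonCrossing (f i) (f k) (f j) (f l)
  nonCrossing-mono f f-mono (inj₁ (out-j , out-l)) = inj₁ (outside out-j , outside out-l)
    where
    outside : ∀ {i k x} → Outside i k x → Outside (f i) (f k) (f x)
    outside (inj₁ (x≤i , x≤k)) = inj₁ (f-mono x≤i , f-mono x≤k)
    outside (inj₂ (i≤x , k≤x)) = inj₂ (f-mono i≤x , f-mono k≤x)
  nonCrossing-mono f f-mono (inj₂ (wit-j , wit-l)) = inj₂ (within wit-j , within wit-l)
    where
    within : ∀ {i k x} → Within i k x → Within (f i) (f k) (f x)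
    within (inj₁ (i≤x , x≤k)) = inj₁ (f-mono i≤x , f-mono x≤k)
    within (inj₂ (k≤x , x≤i)) = inj₂ (f-mono k≤x , f-mono x≤i)

  outside⇒nonCrossing : ∀ {i k j l} → Outside j l i → Outside j l k → NonCrossing i k j l
  outside⇒nonCrossing (inj₁ (i≤j , i≤l)) (inj₁ (k≤j , k≤l)) = inj₁ (inj₂ (i≤j , k≤j) , inj₂ (i≤l , k≤l))
  outside⇒nonCrossing (inj₂ (j≤i , l≤i)) (inj₂ (j≤k , l≤k)) = inj₁ (inj₁ (j≤i , j≤k) , inj₁ (l≤i , l≤k))
  outside⇒nonCrossing (inj₁ (i≤j , i≤l)) (inj₂ (j≤k , l≤k)) = inj₂ (inj₁ (i≤j , j≤k) , inj₁ (i≤l , l≤k))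
  outside⇒nonCrossing (inj₂ (j≤i , l≤i)) (inj₁ (k≤j , k≤l)) = inj₂ (inj₂ (k≤j , j≤i) , inj₂ (k≤l , l≤i))

  block-< : ∀ {n i j p} q → p < n → i < j → i * n + p < j * n + q
  block-< {n} {i} {j} {p} q p<n i<j = begin-strict
    i * n + p  <⟨ +-monoʳ-< (i * n) p<n ⟩
    i * n + n  ≡⟨ +-comm (i * n) n ⟩
    suc i * n  ≤⟨ *-monoˡ-≤ n i<j ⟩
    j * n      ≤⟨ m≤m+n (j * n) q ⟩
    j * n + q  ∎
    where open ≤-Reasoning

  block-injective : ∀ {n i j p q} → p < n → q < n → i * n + p ≡ j * n + q → i ≡ j × p ≡ q
  block-injective {n} {i} {j} {p} {q} p<n q<n eq with <-cmp i j
  ... | tri< i<j _ _  = ⊥-elim (<-irrefl eq (block-< q p<n i<j))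
  ... | tri> _ _ j<i  = ⊥-elim (<-irrefl (sym eq) (block-< p q<n j<i))
  ... | tri≈ _ refl _ = refl , +-cancelˡ-≡ (i * n) p q eq

  otherBlock-outside : ∀ {n p q r} i j → p < n → q < n → r < n → i ≢ j →
                       Outside (j * n + q) (j * n + r) (i * n + p)
  otherBlock-outside {p = p} {q} {r} i j p<n q<n r<n i≢j with <-cmp i j
  ... | tri< i<j _ _ = inj₁ (<⇒≤ (block-< q p<n i<j) , <⇒≤ (block-< r p<n i<j))
  ... | tri≈ _ i≡j _ = ⊥-elim (i≢j i≡j)
  ... | tri> _ _ j<i = inj₂ (<⇒≤ (block-< p q<n j<i) , <⇒≤ (block-< p r<n j<i))

  firstOfBlock-outside : ∀ {n p q r} i j → q < n → r < n → p ≤ q → p ≤ r →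
                         Outside (j * n + q) (j * n + r) (i * n + p)
  firstOfBlock-outside {n} {p} {q} {r} i j q<n r<n p≤q p≤r with i ≤? j
  ... | yes i≤j = inj₁ (+-mono-≤ (*-monoˡ-≤ n i≤j) p≤q , +-mono-≤ (*-monoˡ-≤ n i≤j) p≤r)
  ... | no i≰j  = inj₂ (<⇒≤ (block-< p q<n (≰⇒> i≰j)) , <⇒≤ (block-< p r<n (≰⇒> i≰j)))

  module _ {A C : STData} (eA : OnePageEmbedding A) (eC : OnePageEmbedding C) where
    private
      module eA = OnePageEmbedding eA
      module eC = OnePageEmbedding eC
      open STData (compose A C) using (W; E)

      n : ℕ
      n = eC.bound

      rank : W → ℕ
      rank (a , y) = eA.rank a * n + eC.rank y

      rank-injective : ∀ u v → rank u ≡ rank v → u ≡ v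
      rank-injective (a , y) (b , z) eq with block-injective (eC.rank<bound y) (eC.rank<bound z) eq
      ... | ra≡rb , ry≡rz = cong₂ _,_ (eA.rank-injective a b ra≡rb) (eC.rank-injective y z ry≡rz)

      start-outside : ∀ a c y z → Outside (rank (c , y)) (rank (c , z)) (rank (a , STData.s C))
      start-outside a c y z = firstOfBlock-outside (eA.rank a) (eA.rank c)
        (eC.rank<bound y) (eC.rank<bound z) (eC.s-first y) (eC.s-first z)

      other-outside : ∀ a c x y z → eA.rank a ≢ eA.rank c →
                            Outside (rank (c , y)) (rank (c , z)) (rank (a , x))
      other-outside a c x y z = otherBlock-outside (eA.rank a) (eA.rank c)
        (eC.rank<bound x) (eC.rank<bound y) (eC.rank<bound z)

      nonCrossing : ∀ {u v w x} → E u v → E w x → NonCrossing (rank u) (rank v) (rank w) (rank x)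
      nonCrossing (inj₁ (refl , refl , ab)) (inj₁ (refl , refl , cd)) =
        nonCrossing-mono (λ i → i * n + eC.rank (STData.s C))
          (λ i≤j → +-monoˡ-≤ (eC.rank (STData.s C)) (*-monoˡ-≤ n i≤j)) (eA.nonCrossing ab cd)
      nonCrossing {a , _} {b , _} {c , w} {_ , x} (inj₁ (refl , refl , _)) (inj₂ (refl , _)) =
        outside⇒nonCrossing (start-outside a c w x) (start-outside b c w x)
      nonCrossing {a , y} {_ , z} {c , _} {d , _} (inj₂ (refl , _)) (inj₁ (refl , refl , _)) =
        inj₁ (start-outside c a y z , start-outside d a y z)
      nonCrossing {a , y} {_ , z} {c , w} {_ , x} (inj₂ (refl , yz)) (inj₂ (refl , wx))
        with eA.rank a ≟ eA.rank c
      ... | yes ra≡rc rewrite ra≡rc =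
        nonCrossing-mono (eA.rank c * n +_) (+-monoʳ-≤ (eA.rank c * n)) (eC.nonCrossing yz wx)
      ... | no ra≢rc =
        inj₁ (other-outside c a w y z (ra≢rc ∘ sym) , other-outside c a x y z (ra≢rc ∘ sym))

    compose-embedding : OnePageEmbedding (compose A C)
    compose-embedding = record
      { rank           = rank
      ; bound          = eA.bound * n
      ; rank<bound     = λ (a , y) → subst (rank (a , y) <_) (+-identityʳ (eA.bound * n))
                                       (block-< 0 (eC.rank<bound y) (eA.rank<bound a))
      ; rank-injective = rank-injective
      ; s-first        = λ (a , y) → +-mono-≤ (*-monoˡ-≤ n (eA.s-first a)) (eC.s-first y)
      ; nonCrossing    = nonCrossing
      }

open BookEmbeddings

module ParabolaDrawing {D : STData} (B : OnePageEmbedding D) where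

  import Data.Nat as ℕ
  import Data.Nat.Properties as ℕ
  open import Data.Maybe using (Maybe; just; nothing)
  open import Data.Rational using (ℚ; 0ℚ; _*_; _-_; -_; _≤_; _<_)
  open import Data.Rational.Properties using (<⇒≤; <⇒≢)
  open STData D
  open OnePageEmbedding B
  open Graph (stGraph D)

  X : W → ℚ
  X a = ι (rank a)

  M : ℚ
  M = ι (bound ℕ.* bound)

  apex : Point
  apex = 0ℚ , - M

  pos : Maybe W → Point
  pos nothing  = apex
  pos (just a) = parabola (X a)

  X-injective : ∀ {a b} → X a ≡ X b → a ≡ b
  X-injective Xa≡Xb = rank-injective _ _ (ι-injective Xa≡Xb)

  X*X<M : ∀ a b → X a * X b < M
  X*X<M a b = subst (_< M) (ι-homo-* (rank a) (rank b))
                (ι-mono-< (ℕ.*-mono-< (rank<bound a) (rank<bound b)))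

  rank≤⇒0≤X-X : ∀ {a b} → rank a ℕ.≤ rank b → 0ℚ ≤ X b - X a
  rank≤⇒0≤X-X = p≤q⇒0≤q-p ∘ ι-mono-≤

  rank≤⇒X-X≤0 : ∀ {a b} → rank a ℕ.≤ rank b → X a - X b ≤ 0ℚ
  rank≤⇒X-X≤0 = p≤q⇒p-q≤0 ∘ ι-mono-≤

  chord-at-apex<0 : ∀ a b → chord (X a) (X b) at apex < 0ℚ
  chord-at-apex<0 a b = subst (_< 0ℚ) (sym (chord-at-apex (X a) (X b) M)) (p<q⇒p-q<0 (X*X<M a b))

  -- The tangent to the parabola at the point of a passes above the apex.
  apex≢pos : ∀ a → apex ≢ pos (just a)
  apex≢pos a apex≡Pa = <⇒≢ (chord-at-apex<0 a a)
    (trans (cong (chord (X a) (X a) at_) apex≡Pa) (proj₁ (chord-through (X a) (X a))))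

  chord-zero⇒endpoint : ∀ a b c → chord (X a) (X b) at pos (just c) ≡ 0ℚ → c ≡ a ⊎ c ≡ b
  chord-zero⇒endpoint a b c chord≡0 = Sum.map (X-injective ∘ p-q≡0⇒p≡q) (X-injective ∘ p-q≡0⇒p≡q)
    (p*q≡0⇒p≡0∨q≡0 (trans (sym (chord-at-parabola (X a) (X b) (X c))) chord≡0))

  spoke-zero⇒endpoint : ∀ c d → spoke M (X c) at pos (just d) ≡ 0ℚ → d ≡ c
  spoke-zero⇒endpoint c d spoke≡0
    with p*q≡0⇒p≡0∨q≡0 (trans (sym (spoke-at-parabola M (X c) (X d))) spoke≡0)
  ... | inj₁ Xd-Xc≡0   = X-injective (p-q≡0⇒p≡q Xd-Xc≡0)
  ... | inj₂ XcXd-M≡0 = ⊥-elim (<⇒≢ (p<q⇒p-q<0 (X*X<M c d)) XcXd-M≡0)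

  outside⇒sameSign : ∀ {a b c} → Outside (rank a) (rank b) (rank c) → SameSign (X c - X a) (X c - X b)
  outside⇒sameSign (inj₁ (c≤a , c≤b)) = inj₂ (rank≤⇒X-X≤0 c≤a , rank≤⇒X-X≤0 c≤b)
  outside⇒sameSign (inj₂ (a≤c , b≤c)) = inj₁ (rank≤⇒0≤X-X a≤c , rank≤⇒0≤X-X b≤c)

  within⇒oppositeSign : ∀ {a b c} → Within (rank a) (rank b) (rank c) →
                        OppositeSign (X c - X a) (X c - X b)
  within⇒oppositeSign (inj₁ (a≤c , c≤b)) = inj₁ (rank≤⇒0≤X-X a≤c , rank≤⇒X-X≤0 c≤b)
  within⇒oppositeSign (inj₂ (b≤c , c≤a)) = inj₂ (rank≤⇒X-X≤0 c≤a , rank≤⇒0≤X-X b≤c)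

  chord-nonNeg-outside : ∀ {a b c} → Outside (rank a) (rank b) (rank c) →
                         0ℚ ≤ chord (X a) (X b) at pos (just c)
  chord-nonNeg-outside {a} {b} {c} out = subst (0ℚ ≤_) (sym (chord-at-parabola (X a) (X b) (X c)))
                                           (sameSign⇒0≤* (outside⇒sameSign out))

  chord-nonPos-within : ∀ {a b c} → Within (rank a) (rank b) (rank c) →
                        chord (X a) (X b) at pos (just c) ≤ 0ℚ
  chord-nonPos-within {a} {b} {c} wit = subst (_≤ 0ℚ) (sym (chord-at-parabola (X a) (X b) (X c)))
                                          (oppositeSign⇒*≤0 (within⇒oppositeSign wit))

  spoke-nonNeg-left : ∀ {c d} → rank d ℕ.≤ rank c → 0ℚ ≤ spoke M (X c) at pos (just d)
  spoke-nonNeg-left {c} {d} d≤c = subst (0ℚ ≤_) (sym (spoke-at-parabola M (X c) (X d)))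
    (sameSign⇒0≤* (inj₂ (rank≤⇒X-X≤0 d≤c , <⇒≤ (p<q⇒p-q<0 (X*X<M c d)))))

  spoke-nonPos-right : ∀ {c d} → rank c ℕ.≤ rank d → spoke M (X c) at pos (just d) ≤ 0ℚ
  spoke-nonPos-right {c} {d} c≤d = subst (_≤ 0ℚ) (sym (spoke-at-parabola M (X c) (X d)))
    (oppositeSign⇒*≤0 (inj₁ (rank≤⇒0≤X-X c≤d , <⇒≤ (p<q⇒p-q<0 (X*X<M c d)))))

  nonCrossing⇒chord-sameSign : ∀ {a b c d} → NonCrossing (rank a) (rank b) (rank c) (rank d) →
    SameSign (chord (X a) (X b) at pos (just c)) (chord (X a) (X b) at pos (just d))
  nonCrossing⇒chord-sameSign (inj₁ (out-c , out-d)) =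
    inj₁ (chord-nonNeg-outside out-c , chord-nonNeg-outside out-d)
  nonCrossing⇒chord-sameSign (inj₂ (wit-c , wit-d)) =
    inj₂ (chord-nonPos-within wit-c , chord-nonPos-within wit-d)

  -- Either c lies between a and b, and then both the apex and the point of c are below the
  -- chord, or a and b lie on the same side of c, and then on the same side of the spoke at c.
  chord-vs-spoke : ∀ a b c →
    SameSign (chord (X a) (X b) at apex) (chord (X a) (X b) at pos (just c)) ⊎
    SameSign (spoke M (X c) at pos (just a)) (spoke M (X c) at pos (just b))
  chord-vs-spoke a b c with ℕ.≤-total (rank a) (rank c) | ℕ.≤-total (rank b) (rank c)
  ... | inj₁ a≤c | inj₁ b≤c = inj₂ (inj₁ (spoke-nonNeg-left a≤c , spoke-nonNeg-left b≤c))
  ... | inj₂ c≤a | inj₂ c≤b = inj₂ (inj₂ (spoke-nonPos-right c≤a , spoke-nonPos-right c≤b))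
  ... | inj₁ a≤c | inj₂ c≤b =
    inj₁ (inj₂ (<⇒≤ (chord-at-apex<0 a b) , chord-nonPos-within (inj₁ (a≤c , c≤b))))
  ... | inj₂ c≤a | inj₁ b≤c =
    inj₁ (inj₂ (<⇒≤ (chord-at-apex<0 a b) , chord-nonPos-within (inj₂ (b≤c , c≤a))))

  spoke-sameSign-apex : ∀ c d → SameSign (spoke M (X c) at apex) (spoke M (X c) at pos (just d))
  spoke-sameSign-apex c d = subst (λ p → SameSign p (spoke M (X c) at pos (just d)))
                              (sym (proj₁ (spoke-through M (X c)))) (sameSign-0ˡ _)

  line : ∀ u v → Adj u v → AffineForm
  line (just a) (just b) _ = chord (X a) (X b)
  line nothing  (just c) _ = spoke M (X c)
  line (just c) nothing  _ = spoke M (X c)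

  pos-injective : ∀ u v → pos u ≡ pos v → u ≡ v
  pos-injective nothing  nothing  _       = refl
  pos-injective (just a) (just b) Pa≡Pb   = cong just (X-injective (cong proj₁ Pa≡Pb))
  pos-injective nothing  (just a) apex≡Pa = ⊥-elim (apex≢pos a apex≡Pa)
  pos-injective (just a) nothing  Pa≡apex = ⊥-elim (apex≢pos a (sym Pa≡apex))

  line-through : ∀ u v (e : Adj u v) → line u v e at pos u ≡ 0ℚ × line u v e at pos v ≡ 0ℚ
  line-through (just a) (just b) _ = chord-through (X a) (X b)
  line-through nothing  (just c) _ = spoke-through M (X c)
  line-through (just c) nothing  _ = Product.swap (spoke-through M (X c))

  line-avoids : ∀ u v (e : Adj u v) w → line u v e at pos w ≡ 0ℚ → w ≡ u ⊎ w ≡ v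
  line-avoids (just a) (just b) _ nothing  line≡0 = ⊥-elim (<⇒≢ (chord-at-apex<0 a b) line≡0)
  line-avoids (just a) (just b) _ (just c) line≡0 =
    Sum.map (cong just) (cong just) (chord-zero⇒endpoint a b c line≡0)
  line-avoids nothing  (just c) _ nothing  _      = inj₁ refl
  line-avoids nothing  (just c) _ (just d) line≡0 = inj₂ (cong just (spoke-zero⇒endpoint c d line≡0))
  line-avoids (just c) nothing  _ nothing  _      = inj₂ refl
  line-avoids (just c) nothing  _ (just d) line≡0 = inj₁ (cong just (spoke-zero⇒endpoint c d line≡0))

  separates : ∀ u v w x (e : Adj u v) (e′ : Adj w x) →
              SameSign (line u v e at pos w) (line u v e at pos x) ⊎
              SameSign (line w x e′ at pos u) (line w x e′ at pos v)
  separates (just a) (just b) (just c) (just d) e e′ =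
    inj₁ (nonCrossing⇒chord-sameSign (nonCrossing e e′))
  separates (just a) (just b) nothing  (just c) _ _  = chord-vs-spoke a b c
  separates (just a) (just b) (just c) nothing  _ _  = Sum.map₁ sameSign-sym (chord-vs-spoke a b c)
  separates nothing  (just c) (just a) (just b) _ _  = Sum.swap (chord-vs-spoke a b c)
  separates (just c) nothing  (just a) (just b) _ _  =
    Sum.swap (Sum.map₁ sameSign-sym (chord-vs-spoke a b c))
  separates nothing  (just c) nothing  (just d) _ _  = inj₁ (spoke-sameSign-apex c d)
  separates nothing  (just c) (just d) nothing  _ _  = inj₁ (sameSign-sym (spoke-sameSign-apex c d))
  separates (just c) nothing  nothing  (just d) _ _  = inj₁ (spoke-sameSign-apex c d)
  separates (just c) nothing  (just d) nothing  _ _  = inj₁ (sameSign-sym (spoke-sameSign-apex c d))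

  separatingLines : SeparatingLines (stGraph D)
  separatingLines = record
    { pos           = pos
    ; pos-injective = pos-injective
    ; line          = line
    ; line-through  = line-through
    ; line-avoids   = line-avoids
    ; separates     = separates
    }

  planar : Planar (stGraph D)
  planar = separatingLines⇒drawing separatingLines

module SmallBinomialGraphs where

  open import Data.Nat using (ℕ; zero; suc; _≤_; _<_; _≤?_; _<?_; s≤s)
  import Data.Nat.Properties as ℕ
  open import Data.Bool using (Bool; true; false)
  import Data.Bool.Properties as Bool
  open import Data.Vec using (Vec; []; _∷_)
  import Data.Vec.Properties as Vec
  open import Relation.Nullary using (¬?)
  open import Relation.Nullary.Decidable using (_×-dec_; _⊎-dec_; _→-dec_; map′; True; toWitness)

  ∀-Vec? : ∀ k {P : Vec Bool k → Set} → (∀ v → Dec (P v)) → Dec (∀ v → P v)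
  ∀-Vec? zero    P? = map′ (λ { p [] → p }) (λ p → p []) (P? [])
  ∀-Vec? (suc k) P? = map′ (λ { (p , q) (false ∷ v) → p v ; (p , q) (true ∷ v) → q v })
                           (λ p → p ∘ (false ∷_) , p ∘ (true ∷_))
                           (∀-Vec? k (P? ∘ (false ∷_)) ×-dec ∀-Vec? k (P? ∘ (true ∷_)))

  _≟ᵛ_ : ∀ {k} (u v : Vec Bool k) → Dec (u ≡ v)
  _≟ᵛ_ = Vec.≡-dec Bool._≟_

  btAdj? : ∀ k u v → Dec (BTAdj k u v)
  btAdj? zero    _       _       = no λ ()
  btAdj? (suc k) (x ∷ u) (y ∷ v) =
    (x Bool.≟ y ×-dec btAdj? k u v) ⊎-dec (u ≟ᵛ root k ×-dec v ≟ᵛ root k ×-dec ¬? (x Bool.≟ y))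

  smallAB-edge? : ∀ k u v → Dec (STData.E (smallAB k) u v)
  smallAB-edge? k u v = btAdj? k u v ⊎-dec (u ≟ᵛ root k ×-dec ¬? (v ≟ᵛ root k))
                                     ⊎-dec (v ≟ᵛ root k ×-dec ¬? (u ≟ᵛ root k))

  within? : ∀ i k x → Dec (Within i k x)
  within? i k x = (i ≤? x ×-dec x ≤? k) ⊎-dec (k ≤? x ×-dec x ≤? i)

  outside? : ∀ i k x → Dec (Outside i k x)
  outside? i k x = (x ≤? i ×-dec x ≤? k) ⊎-dec (i ≤? x ×-dec k ≤? x)

  nonCrossing? : ∀ i k j l → Dec (NonCrossing i k j l)
  nonCrossing? i k j l = (outside? i k j ×-dec outside? i k l) ⊎-dec (within? i k j ×-dec within? i k l)

  module _ (k : ℕ) (rank : Vec Bool k → ℕ) (bound : ℕ) where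

    IsOnePageEmbedding : Set
    IsOnePageEmbedding =
      (∀ a → rank a < bound) ×
      (∀ a b → rank a ≡ rank b → a ≡ b) ×
      (∀ a → rank (root k) ≤ rank a) ×
      (∀ a b c d → STData.E (smallAB k) a b → STData.E (smallAB k) c d →
                   NonCrossing (rank a) (rank b) (rank c) (rank d))

    isOnePageEmbedding? : Dec IsOnePageEmbedding
    isOnePageEmbedding? =
      ∀-Vec? k (λ a → rank a <? bound) ×-dec
      ∀-Vec? k (λ a → ∀-Vec? k λ b → rank a ℕ.≟ rank b →-dec a ≟ᵛ b) ×-dec
      ∀-Vec? k (λ a → rank (root k) ≤? rank a) ×-dec
      ∀-Vec? k (λ a → ∀-Vec? k λ b → ∀-Vec? k λ c → ∀-Vec? k λ d →
        smallAB-edge? k a b →-dec (smallAB-edge? k c d →-dec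
        nonCrossing? (rank a) (rank b) (rank c) (rank d)))

    checkedEmbedding : True isOnePageEmbedding? → OnePageEmbedding (smallAB k)
    checkedEmbedding ok with toWitness ok
    ... | rank<bound , rank-injective , s-first , nonCrossing = record
      { rank           = rank
      ; bound          = bound
      ; rank<bound     = rank<bound
      ; rank-injective = rank-injective
      ; s-first        = s-first
      ; nonCrossing    = λ {a b c d} → nonCrossing a b c d
      }

  rank₀ : Vec Bool 0 → ℕ
  rank₀ [] = 0

  rank₁ : Vec Bool 1 → ℕ
  rank₁ (false ∷ []) = 0
  rank₁ (true  ∷ []) = 1

  rank₂ : Vec Bool 2 → ℕ
  rank₂ (false ∷ false ∷ []) = 0
  rank₂ (false ∷ true  ∷ []) = 1
  rank₂ (true  ∷ false ∷ []) = 2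
  rank₂ (true  ∷ true  ∷ []) = 3

  -- In binary order the arcs from 000 to 101 and from 100 to 110 would cross.
  rank₃ : Vec Bool 3 → ℕ
  rank₃ (false ∷ false ∷ false ∷ []) = 0
  rank₃ (false ∷ false ∷ true  ∷ []) = 1
  rank₃ (false ∷ true  ∷ false ∷ []) = 2
  rank₃ (false ∷ true  ∷ true  ∷ []) = 3
  rank₃ (true  ∷ false ∷ true  ∷ []) = 4
  rank₃ (true  ∷ false ∷ false ∷ []) = 5
  rank₃ (true  ∷ true  ∷ false ∷ []) = 6
  rank₃ (true  ∷ true  ∷ true  ∷ []) = 7

  smallAB-embedding : ∀ j → j ≤ 3 → OnePageEmbedding (smallAB j)
  smallAB-embedding 0 _ = checkedEmbedding 0 rank₀ 1 _
  smallAB-embedding 1 _ = checkedEmbedding 1 rank₁ 2 _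
  smallAB-embedding 2 _ = checkedEmbedding 2 rank₂ 4 _
  smallAB-embedding 3 _ = checkedEmbedding 3 rank₃ 8 _
  smallAB-embedding (suc (suc (suc (suc _)))) (s≤s (s≤s (s≤s ())))

open SmallBinomialGraphs

module SeriesParallelK₄ where

  open import Data.Nat using (ℕ; suc)
  open import Data.Fin using (Fin; inject₁; fromℕ; toℕ; lower₁) renaming (zero to fz; suc to fs)
  open import Data.Fin.Properties
    using (fromℕ≢inject₁; inject₁-injective; inject₁-lower₁; toℕ-fromℕ; toℕ-injective)
  open import Data.List using (List; []; _∷_; _++_; map)
  open import Data.List.Membership.Propositional using (_∈_; _∉_)
  open import Data.List.Membership.Propositional.Properties using (∈-++⁻; ∈-map⁻; ∈-++⁺ˡ; ∈-++⁺ʳ)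
  open import Data.List.Relation.Unary.Any using (here; there)
  open import Function.Bundles using (Inverse; Equivalence)

  record K₄ {A : Set} (R : A → A → Set) : Set where
    field
      a b c d : A
      ab : R a b
      ac : R a c
      ad : R a d
      bc : R b c
      bd : R b d
      cd : R c d

  module _ {A : Set} {R : A → A → Set} where

    K₄-map : ∀ {B : Set} {S : B → B → Set} (f : A → B) → (∀ {u v} → R u v → S (f u) (f v)) →
             K₄ R → K₄ S
    K₄-map f hom k = record
      { a = f a ; b = f b ; c = f c ; d = f d
      ; ab = hom ab ; ac = hom ac ; ad = hom ad ; bc = hom bc ; bd = hom bd ; cd = hom cd }
      where open K₄ k

    K₄-rotate : (∀ {u v} → R u v → R v u) → K₄ R → K₄ R
    K₄-rotate sym-R k = record
      { a = b ; b = c ; c = d ; d = a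
      ; ab = bc ; ac = bd ; ad = sym-R ab ; bc = cd ; bd = sym-R ac ; cd = sym-R ad }
      where open K₄ k

    -- Pigeonhole: two of the three other vertices would coincide.
    K₄-degree≥3 : (∀ v → ¬ R v v) → (k : K₄ R) → ∀ x y → ¬ (∀ w → R (K₄.a k) w → w ≡ x ⊎ w ≡ y)
    K₄-degree≥3 irrefl k x y nbrs = go (nbrs b ab) (nbrs c ac) (nbrs d ad)
      where
      open K₄ k
      go : b ≡ x ⊎ b ≡ y → c ≡ x ⊎ c ≡ y → d ≡ x ⊎ d ≡ y → ⊥
      go (inj₁ refl) (inj₁ refl) _          = irrefl b bc
      go (inj₂ refl) (inj₂ refl) _          = irrefl b bc
      go (inj₁ refl) (inj₂ refl) (inj₁ refl) = irrefl b bd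
      go (inj₁ refl) (inj₂ refl) (inj₂ refl) = irrefl c cd
      go (inj₂ refl) (inj₁ refl) (inj₁ refl) = irrefl c cd
      go (inj₂ refl) (inj₁ refl) (inj₂ refl) = irrefl b bd

  Edge : ℕ → Set
  Edge n = Fin n × Fin n

  Loopless : ∀ {n} → List (Edge n) → Set
  Loopless es = ∀ a → (a , a) ∉ es

  loopless⇒irreflexive : ∀ {n} {es : List (Edge n)} → Loopless es → ∀ a → ¬ HasEdge es a a
  loopless⇒irreflexive loopless a = Sum.[ loopless a , loopless a ]

  Inject₁-preimage : ∀ {n} → Fin (suc n) → Set
  Inject₁-preimage {n} i = Σ (Fin n) λ j → inject₁ j ≡ i

  inject₁-preimage : ∀ {n} (i : Fin (suc n)) → i ≢ fromℕ n → Inject₁-preimage i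
  inject₁-preimage {n} i i≢n = lower₁ i n≢i , inject₁-lower₁ i n≢i
    where
    n≢i : n ≢ toℕ i
    n≢i n≡i = i≢n (toℕ-injective (trans (sym n≡i) (sym (toℕ-fromℕ n))))

  module Series {n} (xs ys : List (Edge n)) (x y : Fin n) where

    z : Fin (suc n)
    z = fromℕ n

    inject-edge : Edge n → Edge (suc n)
    inject-edge (a , b) = inject₁ a , inject₁ b

    old : List (Edge n)
    old = xs ++ (x , y) ∷ ys

    new : List (Edge (suc n))
    new = map inject-edge xs ++ (inject₁ x , z) ∷ (z , inject₁ y) ∷ map inject-edge ys

    data NewEdge (p q : Fin (suc n)) : Set where
      old-edge : ∀ {a b} → (a , b) ∈ old → p ≡ inject₁ a → q ≡ inject₁ b → NewEdge p q
      into-z   : p ≡ inject₁ x → q ≡ z → NewEdge p q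
      out-of-z : p ≡ z → q ≡ inject₁ y → NewEdge p q

    newEdge : ∀ {p q} → (p , q) ∈ new → NewEdge p q
    newEdge pq∈new with ∈-++⁻ (map inject-edge xs) pq∈new
    ... | inj₁ ∈xs with ∈-map⁻ inject-edge ∈xs
    ...   | _ , ab∈xs , refl = old-edge (∈-++⁺ˡ ab∈xs) refl refl
    newEdge _ | inj₂ (here refl)         = into-z refl refl
    newEdge _ | inj₂ (there (here refl)) = out-of-z refl refl
    newEdge _ | inj₂ (there (there ∈ys)) with ∈-map⁻ inject-edge ∈ys
    ...   | _ , ab∈ys , refl = old-edge (∈-++⁺ʳ xs (there ab∈ys)) refl refl

    old-edges : ∀ {a b} → (inject₁ a , inject₁ b) ∈ new → (a , b) ∈ old
    old-edges e with newEdge e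
    ... | old-edge ab∈old p q with inject₁-injective p | inject₁-injective q
    ...   | refl | refl = ab∈old
    old-edges e | into-z _ q   = ⊥-elim (fromℕ≢inject₁ (sym q))
    old-edges e | out-of-z p _ = ⊥-elim (fromℕ≢inject₁ (sym p))

    z-neighbours : ∀ {v} → HasEdge new z v → v ≡ inject₁ x ⊎ v ≡ inject₁ y
    z-neighbours (inj₁ zv) with newEdge zv
    ... | old-edge _ p _ = ⊥-elim (fromℕ≢inject₁ p)
    ... | into-z p _     = ⊥-elim (fromℕ≢inject₁ p)
    ... | out-of-z _ q   = inj₂ q
    z-neighbours (inj₂ vz) with newEdge vz
    ... | old-edge _ _ q = ⊥-elim (fromℕ≢inject₁ q)
    ... | into-z p _     = inj₁ p
    ... | out-of-z _ q   = ⊥-elim (fromℕ≢inject₁ q)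

    series-loopless : Loopless old → Loopless new
    series-loopless loopless v vv with newEdge vv
    ... | old-edge ab p q with inject₁-injective (trans (sym p) q)
    ...   | refl = loopless _ ab
    series-loopless loopless v vv | into-z p q   = fromℕ≢inject₁ (trans (sym q) p)
    series-loopless loopless v vv | out-of-z p q = fromℕ≢inject₁ (trans (sym p) q)

    -- The new vertex has only two neighbours, so it lies on no K₄.
    series-K₄ : Loopless old → K₄ (HasEdge new) → K₄ (HasEdge old)
    series-K₄ loopless k = record
      { a = proj₁ pa ; b = proj₁ pb ; c = proj₁ pc ; d = proj₁ pd
      ; ab = lift pa pb ab ; ac = lift pa pc ac ; ad = lift pa pd ad
      ; bc = lift pb pc bc ; bd = lift pb pd bd ; cd = lift pc pd cd }
      where
      open K₄ k

      avoids-z : ∀ (k′ : K₄ (HasEdge new)) → K₄.a k′ ≢ z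
      avoids-z k′ refl = K₄-degree≥3 (loopless⇒irreflexive (series-loopless loopless)) k′
                           (inject₁ x) (inject₁ y) (λ _ → z-neighbours)

      rotate : K₄ (HasEdge new) → K₄ (HasEdge new)
      rotate = K₄-rotate Sum.swap

      pa : Inject₁-preimage a
      pa = inject₁-preimage a (avoids-z k)
      pb : Inject₁-preimage b
      pb = inject₁-preimage b (avoids-z (rotate k))
      pc : Inject₁-preimage c
      pc = inject₁-preimage c (avoids-z (rotate (rotate k)))
      pd : Inject₁-preimage d
      pd = inject₁-preimage d (avoids-z (rotate (rotate (rotate k))))

      lift : ∀ {u v} (pu : Inject₁-preimage u) (pv : Inject₁-preimage v) →
             HasEdge new u v → HasEdge old (proj₁ pu) (proj₁ pv)
      lift (_ , refl) (_ , refl) = Sum.map old-edges old-edges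

  ⊆-∷ : ∀ {A : Set} {e : A} {es} → e ∈ es → ∀ {f} → f ∈ e ∷ es → f ∈ es
  ⊆-∷ e∈es (here refl) = e∈es
  ⊆-∷ e∈es (there f∈es) = f∈es

  k₂-other : Fin 2 → Fin 2
  k₂-other fz = fs fz
  k₂-other (fs _) = fz

  k₂-neighbour : ∀ {a b} → HasEdge ((fz , fs fz) ∷ []) a b → b ≡ k₂-other a
  k₂-neighbour (inj₁ (here refl)) = refl
  k₂-neighbour (inj₂ (here refl)) = refl

  spMulti-loopless : ∀ {n es} → SPMulti n es → Loopless es
  spMulti-loopless k2 fz (here ())
  spMulti-loopless k2 (fs fz) (here ())
  spMulti-loopless (series xs ys x y sp) = Series.series-loopless xs ys x y (spMulti-loopless sp)
  spMulti-loopless (parallel sp e∈es) a = spMulti-loopless sp a ∘ ⊆-∷ e∈es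

  spMulti-K₄-free : ∀ {n es} → SPMulti n es → ¬ K₄ (HasEdge es)
  spMulti-K₄-free k2 k = K₄-degree≥3 (loopless⇒irreflexive (spMulti-loopless k2)) k
                           (k₂-other (K₄.a k)) (k₂-other (K₄.a k)) (λ _ → inj₁ ∘ k₂-neighbour)
  spMulti-K₄-free (series xs ys x y sp) =
    spMulti-K₄-free sp ∘ Series.series-K₄ xs ys x y (spMulti-loopless sp)
  spMulti-K₄-free (parallel sp e∈es) =
    spMulti-K₄-free sp ∘ K₄-map id (Sum.map (⊆-∷ e∈es) (⊆-∷ e∈es))

  seriesParallel⇒K₄-free : ∀ G → SeriesParallel G → ¬ K₄ (Graph.Adj G)
  seriesParallel⇒K₄-free G (_ , _ , sp , _ , f , adj⇔edge) = spMulti-K₄-free sp ∘ K₄-map from adj⇒edge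
    where
    open Graph G
    open Inverse f using (from; strictlyInverseˡ)
    adj⇒edge : ∀ {u v} → Adj u v → HasEdge _ (from u) (from v)
    adj⇒edge {u} {v} uv = Equivalence.to (adj⇔edge (from u) (from v))
      (subst₂ Adj (sym (strictlyInverseˡ u)) (sym (strictlyInverseˡ v)) uv)

open SeriesParallelK₄

module AcceleratedBinomialGraphs where

  open import Data.Nat using (ℕ; zero; suc; _+_; _*_; _∸_; _≤_; _<_; z≤n; s≤s)
  open import Data.Nat.Properties using (*-comm; +-∸-assoc; ≤-reflexive; ≤-trans)
  open import Data.Nat.DivMod using (_/_; _%_; m%n≡m∸m/n*n; m/n*n≤m; m%n<n; m≥n⇒m/n>0)
  open import Data.Bool using (Bool; true; false)
  open import Data.Vec using (Vec; []; _∷_)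
  open import Data.Maybe using (just; nothing)
  open import Data.Unit using (tt)
  open import Relation.Nullary.Decidable using (True; toWitness)

  ABm-embedding : ∀ m → OnePageEmbedding (ABm m)
  ABm-embedding zero          = smallAB-embedding 0 z≤n
  ABm-embedding (suc zero)    = smallAB-embedding 3 (s≤s (s≤s (s≤s z≤n)))
  ABm-embedding (suc (suc m)) =
    compose-embedding (ABm-embedding (suc m)) (smallAB-embedding 3 (s≤s (s≤s (s≤s z≤n))))

  suc∸3*[m/3]≡suc[m%3] : ∀ m → suc m ∸ 3 * (m / 3) ≡ suc (m % 3)
  suc∸3*[m/3]≡suc[m%3] m = begin
    suc m ∸ 3 * (m / 3)    ≡⟨ cong (suc m ∸_) (*-comm 3 (m / 3)) ⟩
    suc m ∸ (m / 3) * 3    ≡⟨ +-∸-assoc 1 (m/n*n≤m m 3) ⟩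
    suc (m ∸ (m / 3) * 3)  ≡⟨ cong suc (m%n≡m∸m/n*n m 3) ⟨
    suc (m % 3)            ∎
    where open ≡-Reasoning

  AB-embedding : ∀ k → OnePageEmbedding (ABdata k)
  AB-embedding 0 = smallAB-embedding 0 z≤n
  AB-embedding 1 = smallAB-embedding 1 (s≤s z≤n)
  AB-embedding 2 = smallAB-embedding 2 (s≤s (s≤s z≤n))
  AB-embedding 3 = smallAB-embedding 3 (s≤s (s≤s (s≤s z≤n)))
  AB-embedding (suc (suc (suc (suc n)))) =
    compose-embedding (ABm-embedding ((3 + n) / 3))
      (smallAB-embedding _ (≤-trans (≤-reflexive (suc∸3*[m/3]≡suc[m%3] (3 + n))) (m%n<n (3 + n) 3)))

  AB-planar : ∀ k → Planar (AB k)
  AB-planar k = ParabolaDrawing.planar (AB-embedding k)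

  record Triangle (D : STData) : Set where
    open STData D
    field
      a b c : W
      ab : E a b
      ac : E a c
      bc : E b c

  checkedTriangle : ∀ k (a b c : Vec Bool k) →
                    {True (smallAB-edge? k a b)} → {True (smallAB-edge? k a c)} →
                    {True (smallAB-edge? k b c)} → Triangle (smallAB k)
  checkedTriangle k a b c {ab} {ac} {bc} = record
    { a = a ; b = b ; c = c ; ab = toWitness ab ; ac = toWitness ac ; bc = toWitness bc }

  smallAB₂-triangle : Triangle (smallAB 2)
  smallAB₂-triangle = checkedTriangle 2 (false ∷ false ∷ []) (true ∷ false ∷ []) (true ∷ true ∷ [])

  smallAB₃-triangle : Triangle (smallAB 3)
  smallAB₃-triangle =
    checkedTriangle 3 (false ∷ false ∷ false ∷ []) (true ∷ false ∷ false ∷ [])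
                      (true ∷ true ∷ false ∷ [])

  triangle⇒K₄ : ∀ {D} → Triangle D → K₄ (Graph.Adj (stGraph D))
  triangle⇒K₄ t = record
    { a = nothing ; b = just a ; c = just b ; d = just c
    ; ab = tt ; ac = tt ; ad = tt ; bc = ab ; bd = ac ; cd = bc }
    where open Triangle t

  compose-triangle : ∀ {A C} → Triangle A → Triangle (compose A C)
  compose-triangle {C = C} t = record
    { a = a , s ; b = b , s ; c = c , s
    ; ab = inj₁ (refl , refl , ab) ; ac = inj₁ (refl , refl , ac) ; bc = inj₁ (refl , refl , bc) }
    where
    open Triangle t
    open STData C using (s)

  ABm-triangle : ∀ m → 0 < m → Triangle (ABm m)
  ABm-triangle (suc zero)    _ = smallAB₃-triangle
  ABm-triangle (suc (suc m)) _ = compose-triangle (ABm-triangle (suc m) (s≤s z≤n))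

  AB-triangle : ∀ k → 2 ≤ k → Triangle (ABdata k)
  AB-triangle 0 ()
  AB-triangle 1 (s≤s ())
  AB-triangle 2 _ = smallAB₂-triangle
  AB-triangle 3 _ = smallAB₃-triangle
  AB-triangle (suc (suc (suc (suc n)))) _ =
    compose-triangle (ABm-triangle ((3 + n) / 3) (m≥n⇒m/n>0 {3 + n} (s≤s (s≤s (s≤s z≤n)))))

  AB-not-seriesParallel : ∀ k → 2 ≤ k → ¬ SeriesParallel (AB k)
  AB-not-seriesParallel k 2≤k sp = seriesParallel⇒K₄-free (AB k) sp (triangle⇒K₄ (AB-triangle k 2≤k))

open AcceleratedBinomialGraphs

open import Data.Nat using (ℕ; _≤_)

lemma3 : ((k : ℕ) → Planar (AB k)) × ((k : ℕ) → 2 ≤ k → ¬ SeriesParallel (AB k))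
lemma3 = AB-planar , AB-not-seriesParallel
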